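{- Let $Q$ be a Dedekind quantale and define $\mathit{dom}(\alpha)=1\wedge\alpha\alpha^\circ$ and $\mathit{cod}(\alpha)=1\wedge\alpha^\circ\alpha$. Then $(Q,\mathit{dom},\mathit{cod})$ is a modal quantale.
   Context: A quantale is a complete lattice with an associative multiplication preserving all sups in both arguments and having a unit $1$. An involutive quantale is a quantale with $(-)^\circ$ satisfying $\alpha^{\circ\circ}=\alpha$, $(\bigvee A)^\circ=\bigvee\{\alpha^\circ\mid\alpha\in A\}$, $(\alpha\beta)^\circ=\beta^\circ\alpha^\circ$. A Dedekind quantale is an involutive quantale satisfying $\alpha\beta\wedge\gamma\le(\alpha\wedge\gamma\beta^\circ)(\beta\wedge\alpha^\circ\gamma)$. A modal quantale is a quantale with maps $\mathit{dom},\mathit{cod}$ such that $\alpha\le\mathit{dom}(\alpha)\alpha$, $\mathit{dom}(\alpha\,\mathit{dom}(\beta))=\mathit{dom}(\alpha\beta)$, $\mathit{dom}(\alpha)\le1$, $\mathit{dom}(\bot)=\bot$, $\mathit{dom}(\alpha\vee\beta)=\mathit{dom}(\alpha)\vee\mathit{dom}(\beta)$; symmetrically $\alpha\le\alpha\,\mathit{cod}(\alpha)$, $\mathit{cod}(\mathit{cod}(\alpha)\beta)=\mathit{cod}(\alpha\beta)$, $\mathit{cod}(\alpha)\le 1$, $\mathit{cod}(\bot)=\bot$, $\mathit{cod}(\alpha\vee\beta)=\mathit{cod}(\alpha)\vee\mathit{cod}(\beta)$; and $\mathit{dom}\circ\mathit{cod}=\mathit{cod}$, $\mathit{cod}\circ\mathit{dom}=\mathit{dom}$.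 -}

module Defs where

open import Level using (Level; suc; _⊔_)
open import Data.Product using (Σ; _×_; _,_; ∃)
open import Relation.Binary.Bundles using (Poset)
open import Relation.Unary using (Pred; _∈_)

record CompleteLattice (c ℓ₁ ℓ₂ ℓ : Level) : Set (suc (c ⊔ ℓ₁ ⊔ ℓ₂ ⊔ ℓ)) where
  field
    poset : Poset c ℓ₁ ℓ₂
  open Poset poset public
  field
    ⋁       : Pred Carrier ℓ → Carrier
    ⋁-upper : (A : Pred Carrier ℓ) → ∀ {x} → x ∈ A → x ≤ ⋁ A
    ⋁-least : (A : Pred Carrier ℓ) → ∀ {y} → (∀ {x} → x ∈ A → x ≤ y) → ⋁ A ≤ y

  image : (Carrier → Carrier) → Pred Carrier ℓ → Pred Carrier (c ⊔ ℓ₁ ⊔ ℓ)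
  image f A y = Σ Carrier λ x → x ∈ A × (f x ≈ y)

record Quantale (c ℓ₁ ℓ₂ : Level) : Set (suc (c ⊔ ℓ₁ ⊔ ℓ₂)) where
  field
    lattice : CompleteLattice c ℓ₁ ℓ₂ (c ⊔ ℓ₁ ⊔ ℓ₂)
  open CompleteLattice lattice public
  infixl 7 _·_
  field
    _·_     : Carrier → Carrier → Carrier
    𝟏       : Carrier
    ·-cong  : ∀ {a b c d} → a ≈ b → c ≈ d → (a · c) ≈ (b · d)
    ·-assoc : ∀ a b d → ((a · b) · d) ≈ (a · (b · d))
    ·-idˡ   : ∀ a → (𝟏 · a) ≈ a
    ·-idʳ   : ∀ a → (a · 𝟏) ≈ a
    ·-⋁ʳ    : ∀ (A : Pred Carrier (c ⊔ ℓ₁ ⊔ ℓ₂)) b →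
              (⋁ A · b) ≈ ⋁ (image (λ a → a · b) A)
    ·-⋁ˡ    : ∀ (A : Pred Carrier (c ⊔ ℓ₁ ⊔ ℓ₂)) b →
              (b · ⋁ A) ≈ ⋁ (image (λ a → b · a) A)

  ⊥ : Carrier
  ⊥ = ⋁ (λ _ → Level.Lift (c ⊔ ℓ₁ ⊔ ℓ₂) Data.Empty.⊥)
    where import Data.Empty

  _∨_ : Carrier → Carrier → Carrier
  a ∨ b = ⋁ (λ x → Level.Lift (c ⊔ ℓ₂) ((x ≈ a) Data.Sum.⊎ (x ≈ b)))
    where import Data.Sum

  _∧_ : Carrier → Carrier → Carrier
  a ∧ b = ⋁ (λ x → Level.Lift (c ⊔ ℓ₁) ((x ≤ a) × (x ≤ b)))

  infixr 6 _∨_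
  infixr 6 _∧_

record InvolutiveQuantale (c ℓ₁ ℓ₂ : Level) : Set (suc (c ⊔ ℓ₁ ⊔ ℓ₂)) where
  field
    quantale : Quantale c ℓ₁ ℓ₂
  open Quantale quantale public
  field
    _°       : Carrier → Carrier
    °-cong   : ∀ {a b} → a ≈ b → (a °) ≈ (b °)
    °-invol  : ∀ a → ((a °) °) ≈ a
    °-⋁      : ∀ (A : Pred Carrier (c ⊔ ℓ₁ ⊔ ℓ₂)) → ((⋁ A) °) ≈ ⋁ (image _° A)
    °-·      : ∀ a b → ((a · b) °) ≈ ((b °) · (a °))
  infix 8 _°

record DedekindQuantale (c ℓ₁ ℓ₂ : Level) : Set (suc (c ⊔ ℓ₁ ⊔ ℓ₂)) where
  field
    involutiveQuantale : InvolutiveQuantale c ℓ₁ ℓ₂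
  open InvolutiveQuantale involutiveQuantale public
  field
    dedekind : ∀ a b g → ((a · b) ∧ g) ≤ ((a ∧ (g · (b °))) · (b ∧ ((a °) · g)))

record IsModalQuantale {c ℓ₁ ℓ₂ : Level} (Q : Quantale c ℓ₁ ℓ₂)
       (dom cod : Quantale.Carrier Q → Quantale.Carrier Q) : Set (c ⊔ ℓ₁ ⊔ ℓ₂) where
  open Quantale Q
  field
    dom-absorb : ∀ a → a ≤ (dom a · a)
    dom-local  : ∀ a b → dom (a · dom b) ≈ dom (a · b)
    dom-sub1   : ∀ a → dom a ≤ 𝟏
    dom-strict : dom ⊥ ≈ ⊥
    dom-join   : ∀ a b → dom (a ∨ b) ≈ (dom a ∨ dom b)
    cod-absorb : ∀ a → a ≤ (a · cod a)
    cod-local  : ∀ a b → cod (cod a · b) ≈ cod (a · b)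
    cod-sub1   : ∀ a → cod a ≤ 𝟏
    cod-strict : cod ⊥ ≈ ⊥
    cod-join   : ∀ a b → cod (a ∨ b) ≈ (cod a ∨ cod b)
    dom-cod    : ∀ a → dom (cod a) ≈ cod a
    cod-dom    : ∀ a → cod (dom a) ≈ dom a

{-# OPTIONS --safe #-}
-- The Dedekind law with unit arguments yields the two facts everything rests on:
-- a ≤ dom(a)·a, and dom(x) ≤ p for every subidentity p with x ≤ p·x.  So dom(x) is
-- the least subidentity that left-absorbs x, from which locality, strictness and
-- additivity follow by monotonicity.  Codomain is domain in the opposite
-- quantale, which is again Dedekind.
module Submission where

open import Defs
open import Level using (lift)
open import Data.Product using (_,_)
open import Data.Sum using (inj₁; inj₂)
import Relation.Binary.Reasoning.PartialOrder as PartialOrderReasoning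

module QuantaleProperties {c ℓ₁ ℓ₂} (Q : Quantale c ℓ₁ ℓ₂) where
  open Quantale Q
  open PartialOrderReasoning poset

  x∧y≤x : ∀ {x y} → x ∧ y ≤ x
  x∧y≤x = ⋁-least _ λ { (lift (x′≤x , _)) → x′≤x }

  x∧y≤y : ∀ {x y} → x ∧ y ≤ y
  x∧y≤y = ⋁-least _ λ { (lift (_ , x′≤y)) → x′≤y }

  ∧-greatest : ∀ {x y z} → z ≤ x → z ≤ y → z ≤ x ∧ y
  ∧-greatest z≤x z≤y = ⋁-upper _ (lift (z≤x , z≤y))

  x≤x∨y : ∀ {x y} → x ≤ x ∨ y
  x≤x∨y = ⋁-upper _ (lift (inj₁ Eq.refl))

  y≤x∨y : ∀ {x y} → y ≤ x ∨ y
  y≤x∨y = ⋁-upper _ (lift (inj₂ Eq.refl))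

  ∨-least : ∀ {x y z} → x ≤ z → y ≤ z → x ∨ y ≤ z
  ∨-least x≤z y≤z = ⋁-least _ λ
    { (lift (inj₁ x′≈x)) → trans (reflexive x′≈x) x≤z
    ; (lift (inj₂ x′≈y)) → trans (reflexive x′≈y) y≤z
    }

  ⊥-minimum : ∀ {x} → ⊥ ≤ x
  ⊥-minimum = ⋁-least _ λ { (lift ()) }

  x≤y⇒x∨y≈y : ∀ {x y} → x ≤ y → x ∨ y ≈ y
  x≤y⇒x∨y≈y x≤y = antisym (∨-least x≤y refl) y≤x∨y

  -- Monotonicity is preservation of the binary join x ∨ y = y.
  ·-monoˡ-≤ : ∀ {x y z} → x ≤ y → x · z ≤ y · z
  ·-monoˡ-≤ {x} {y} {z} x≤y = begin
    x · z                     ≤⟨ ⋁-upper _ (x , lift (inj₁ Eq.refl) , Eq.refl) ⟩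
    ⋁ (image (λ w → w · z) _) ≈⟨ ·-⋁ʳ _ z ⟨
    (x ∨ y) · z               ≈⟨ ·-cong (x≤y⇒x∨y≈y x≤y) Eq.refl ⟩
    y · z                     ∎

  ·-monoʳ-≤ : ∀ {x y z} → x ≤ y → z · x ≤ z · y
  ·-monoʳ-≤ {x} {y} {z} x≤y = begin
    z · x                     ≤⟨ ⋁-upper _ (x , lift (inj₁ Eq.refl) , Eq.refl) ⟩
    ⋁ (image (λ w → z · w) _) ≈⟨ ·-⋁ˡ _ z ⟨
    z · (x ∨ y)               ≈⟨ ·-cong Eq.refl (x≤y⇒x∨y≈y x≤y) ⟩
    z · y                     ∎

  ·-mono-≤ : ∀ {x y u v} → x ≤ y → u ≤ v → x · u ≤ y · v
  ·-mono-≤ x≤y u≤v = trans (·-monoˡ-≤ x≤y) (·-monoʳ-≤ u≤v)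

module InvolutiveQuantaleProperties {c ℓ₁ ℓ₂} (Q : InvolutiveQuantale c ℓ₁ ℓ₂) where
  open InvolutiveQuantale Q
  open QuantaleProperties quantale
  open PartialOrderReasoning poset

  °-mono-≤ : ∀ {x y} → x ≤ y → x ° ≤ y °
  °-mono-≤ {x} {y} x≤y = begin
    x °            ≤⟨ ⋁-upper _ (x , lift (inj₁ Eq.refl) , Eq.refl) ⟩
    ⋁ (image _° _) ≈⟨ °-⋁ _ ⟨
    (x ∨ y) °      ≈⟨ °-cong (x≤y⇒x∨y≈y x≤y) ⟩
    y °            ∎

  𝟏°≈𝟏 : 𝟏 ° ≈ 𝟏
  𝟏°≈𝟏 = begin-equality
    𝟏 °             ≈⟨ ·-idʳ (𝟏 °) ⟨
    𝟏 ° · 𝟏         ≈⟨ ·-cong Eq.refl (°-invol 𝟏) ⟨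
    𝟏 ° · (𝟏 °) °   ≈⟨ °-· (𝟏 °) 𝟏 ⟨
    (𝟏 ° · 𝟏) °     ≈⟨ °-cong (·-idʳ (𝟏 °)) ⟩
    (𝟏 °) °         ≈⟨ °-invol 𝟏 ⟩
    𝟏               ∎

  x≤𝟏⇒x°≤𝟏 : ∀ {x} → x ≤ 𝟏 → x ° ≤ 𝟏
  x≤𝟏⇒x°≤𝟏 x≤𝟏 = trans (°-mono-≤ x≤𝟏) (reflexive 𝟏°≈𝟏)

module DedekindQuantaleProperties {c ℓ₁ ℓ₂} (Q : DedekindQuantale c ℓ₁ ℓ₂) where
  open DedekindQuantale Q
  open QuantaleProperties quantale
  open InvolutiveQuantaleProperties involutiveQuantale
  open PartialOrderReasoning poset

  dom : Carrier → Carrier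
  dom x = 𝟏 ∧ (x · x °)

  dom≤𝟏 : ∀ x → dom x ≤ 𝟏
  dom≤𝟏 x = x∧y≤x

  dom-mono-≤ : ∀ {x y} → x ≤ y → dom x ≤ dom y
  dom-mono-≤ x≤y = ∧-greatest x∧y≤x (trans x∧y≤y (·-mono-≤ x≤y (°-mono-≤ x≤y)))

  x≤dom[x]·x : ∀ x → x ≤ dom x · x
  x≤dom[x]·x x = begin
    x                               ≤⟨ ∧-greatest (reflexive (Eq.sym (·-idˡ x))) refl ⟩
    (𝟏 · x) ∧ x                     ≤⟨ dedekind 𝟏 x x ⟩
    dom x · (x ∧ (𝟏 ° · x))         ≤⟨ ·-monoʳ-≤ x∧y≤x ⟩
    dom x · x                       ∎

  dom-least : ∀ {p x} → p ≤ 𝟏 → x ≤ p · x → dom x ≤ p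
  dom-least {p} {x} p≤𝟏 x≤p·x = begin
    dom x                                         ≤⟨ ∧-greatest (trans x∧y≤y x·x°≤p·x·x°) x∧y≤x ⟩
    (p · (x · x °)) ∧ 𝟏                           ≤⟨ dedekind p (x · x °) 𝟏 ⟩
    (p ∧ (𝟏 · (x · x °) °)) · ((x · x °) ∧ (p ° · 𝟏)) ≤⟨ ·-mono-≤ x∧y≤x (trans x∧y≤y p°·𝟏≤𝟏) ⟩
    p · 𝟏                                         ≈⟨ ·-idʳ p ⟩
    p                                             ∎
    where
    x·x°≤p·x·x° : x · x ° ≤ p · (x · x °)
    x·x°≤p·x·x° = trans (·-monoˡ-≤ x≤p·x) (reflexive (·-assoc p x (x °)))
    p°·𝟏≤𝟏 : p ° · 𝟏 ≤ 𝟏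
    p°·𝟏≤𝟏 = trans (reflexive (·-idʳ (p °))) (x≤𝟏⇒x°≤𝟏 p≤𝟏)

  dom-⊥ : dom ⊥ ≈ ⊥
  dom-⊥ = antisym (dom-least ⊥-minimum ⊥-minimum) ⊥-minimum

  dom-∨ : ∀ x y → dom (x ∨ y) ≈ dom x ∨ dom y
  dom-∨ x y = antisym
    (dom-least (∨-least (dom≤𝟏 x) (dom≤𝟏 y))
               (∨-least (trans (x≤dom[x]·x x) (·-mono-≤ x≤x∨y x≤x∨y))
                        (trans (x≤dom[x]·x y) (·-mono-≤ y≤x∨y y≤x∨y))))
    (∨-least (dom-mono-≤ x≤x∨y) (dom-mono-≤ y≤x∨y))

  dom[x·y]≤dom[x] : ∀ x y → dom (x · y) ≤ dom x
  dom[x·y]≤dom[x] x y = dom-least (dom≤𝟏 x)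
    (trans (·-monoˡ-≤ (x≤dom[x]·x x)) (reflexive (·-assoc (dom x) x y)))

  dom-local : ∀ x y → dom (x · dom y) ≈ dom (x · y)
  dom-local x y = antisym (∧-greatest x∧y≤x (trans x∧y≤y xdom[y]²≤[x·y]²)) (begin
    dom (x · y)           ≤⟨ dom-mono-≤ (trans (·-monoʳ-≤ (x≤dom[x]·x y)) (reflexive (Eq.sym (·-assoc x (dom y) y)))) ⟩
    dom ((x · dom y) · y) ≤⟨ dom[x·y]≤dom[x] (x · dom y) y ⟩
    dom (x · dom y)       ∎)
    where
    xdom[y]²≤[x·y]² : (x · dom y) · (x · dom y) ° ≤ (x · y) · (x · y) °
    xdom[y]²≤[x·y]² = begin
      (x · dom y) · (x · dom y) °         ≈⟨ ·-cong Eq.refl (°-· x (dom y)) ⟩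
      (x · dom y) · (dom y ° · x °)       ≤⟨ ·-mono-≤ (·-monoʳ-≤ x∧y≤y) (·-monoˡ-≤ (x≤𝟏⇒x°≤𝟏 (dom≤𝟏 y))) ⟩
      (x · (y · y °)) · (𝟏 · x °)         ≈⟨ ·-cong Eq.refl (·-idˡ (x °)) ⟩
      (x · (y · y °)) · x °               ≈⟨ ·-assoc x (y · y °) (x °) ⟩
      x · ((y · y °) · x °)               ≈⟨ ·-cong Eq.refl (·-assoc y (y °) (x °)) ⟩
      x · (y · (y ° · x °))               ≈⟨ ·-assoc x y (y ° · x °) ⟨
      (x · y) · (y ° · x °)               ≈⟨ ·-cong Eq.refl (°-· x y) ⟨
      (x · y) · (x · y) °                 ∎

  x≤𝟏⇒dom[x]≈x : ∀ {p} → p ≤ 𝟏 → dom p ≈ p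
  x≤𝟏⇒dom[x]≈x {p} p≤𝟏 = antisym
    (trans x∧y≤y (trans (·-monoʳ-≤ (x≤𝟏⇒x°≤𝟏 p≤𝟏)) (reflexive (·-idʳ p))))
    (trans (x≤dom[x]·x p) (trans (·-monoʳ-≤ p≤𝟏) (reflexive (·-idʳ (dom p)))))

opposite : ∀ {c ℓ₁ ℓ₂} → DedekindQuantale c ℓ₁ ℓ₂ → DedekindQuantale c ℓ₁ ℓ₂
opposite Q = record
  { involutiveQuantale = record
    { quantale = record
      { lattice = lattice
      ; _·_     = λ x y → y · x
      ; 𝟏       = 𝟏
      ; ·-cong  = λ x≈y u≈v → ·-cong u≈v x≈y
      ; ·-assoc = λ x y z → Eq.sym (·-assoc z y x)
      ; ·-idˡ   = ·-idʳ
      ; ·-idʳ   = ·-idˡ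
      ; ·-⋁ʳ    = ·-⋁ˡ
      ; ·-⋁ˡ    = ·-⋁ʳ
      }
    ; _°      = _°
    ; °-cong  = °-cong
    ; °-invol = °-invol
    ; °-⋁     = °-⋁
    ; °-·     = λ x y → °-· y x
    }
  ; dedekind = λ x y z → dedekind y x z
  }
  where open DedekindQuantale Q

proposition5p6 : ∀ {c ℓ₁ ℓ₂} (Q : DedekindQuantale c ℓ₁ ℓ₂) →
    let open DedekindQuantale Q in
    IsModalQuantale quantale (λ a → 𝟏 ∧ (a · (a °))) (λ a → 𝟏 ∧ ((a °) · a))
proposition5p6 Q = record
  { dom-absorb = D.x≤dom[x]·x
  ; dom-local  = D.dom-local
  ; dom-sub1   = D.dom≤𝟏
  ; dom-strict = D.dom-⊥
  ; dom-join   = D.dom-∨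
  ; cod-absorb = C.x≤dom[x]·x
  ; cod-local  = λ x y → C.dom-local y x
  ; cod-sub1   = C.dom≤𝟏
  ; cod-strict = C.dom-⊥
  ; cod-join   = C.dom-∨
  ; dom-cod    = λ x → D.x≤𝟏⇒dom[x]≈x (C.dom≤𝟏 x)
  ; cod-dom    = λ x → C.x≤𝟏⇒dom[x]≈x (D.dom≤𝟏 x)
  }
  where
  module D = DedekindQuantaleProperties Q
  module C = DedekindQuantaleProperties (opposite Q)
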